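{- If $k\geq10$, then $\gamma(P_{k}\diamond P)=\gamma(C_{k}\diamond P)=4$, where $P$ is the Petersen graph.
   Context: $P_k$ is the path on $k$ vertices, $C_k$ the cycle on $k$ vertices, and $P$ the Petersen graph. The modular product $G\diamond H$ has vertex set $V(G)\times V(H)$, and two distinct vertices $(g,h)$ and $(g',h')$ are adjacent iff either ($g=g'$ and $hh'\in E(H)$), or ($gg'\in E(G)$ and $h=h'$), or ($gg'\in E(G)$ and $hh'\in E(H)$), or ($g\neq g'$, $h\neq h'$, $gg'\notin E(G)$ and $hh'\notin E(H)$). $\gamma$ is the domination number. -}

module Defs where

open import Data.Nat using (ℕ; zero; suc; _+_; _∸_; _*_; _%_; _≡ᵇ_; _<ᵇ_; _≤ᵇ_)
open import Data.Bool using (Bool; true; false; _∧_; _∨_; not)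
open import Data.Fin using (Fin; toℕ; combine; remQuot)
open import Data.Fin.Subset using (Subset; _∈_; ∣_∣)
open import Data.Product using (Σ; ∃; ∃-syntax; _×_; _,_; proj₁; proj₂)
open import Data.Sum using (_⊎_)
open import Relation.Nullary using (¬_)
open import Relation.Binary.PropositionalEquality using (_≡_)

record Graph : Set where
  constructor mkGraph
  field
    order : ℕ
    adj   : Fin order → Fin order → Bool

open Graph public

eqF : ∀ {n} → Fin n → Fin n → Bool
eqF i j = toℕ i ≡ᵇ toℕ j

pathAdj : ℕ → ℕ → Bool
pathAdj i j = (suc i ≡ᵇ j) ∨ (suc j ≡ᵇ i)

Path : ℕ → Graph
Path k = mkGraph k (λ i j → pathAdj (toℕ i) (toℕ j))

-- Cycle C_k (k ≥ 3) on vertices 0..k-1: i ~ j iff j ≡ i+1 or i ≡ j+1 (mod k)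
cycleAdj : ℕ → ℕ → ℕ → Bool
cycleAdj k i j = ((suc i % suc (k ∸ 1)) ≡ᵇ j) ∨ ((suc j % suc (k ∸ 1)) ≡ᵇ i)

Cycle : ℕ → Graph
Cycle k = mkGraph k (λ i j → cycleAdj k (toℕ i) (toℕ j))

-- Petersen graph on 0..9: outer 5-cycle 0..4 (i ~ i+1 mod 5),
-- inner pentagram 5..9 (5+i ~ 5+((i+2) mod 5)), spokes i ~ 5+i.
petAdj' : ℕ → ℕ → Bool
petAdj' i j =
     ((i <ᵇ 5) ∧ (j <ᵇ 5) ∧ ((suc i % 5) ≡ᵇ j))
  ∨ ((5 ≤ᵇ i) ∧ (5 ≤ᵇ j) ∧ ((5 + ((i ∸ 5 + 2) % 5)) ≡ᵇ j))
  ∨ ((i <ᵇ 5) ∧ ((i + 5) ≡ᵇ j))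

Petersen : Graph
Petersen = mkGraph 10 (λ i j → petAdj' (toℕ i) (toℕ j) ∨ petAdj' (toℕ j) (toℕ i))

-- Modular product G ⋄ H on V(G) × V(H) (encoded as Fin (|G| * |H|) via combine).
modAdj : (G H : Graph) → Fin (order G) → Fin (order H) → Fin (order G) → Fin (order H) → Bool
modAdj G H g h g' h' =
  not (eqF g g' ∧ eqF h h') ∧
  (  (eqF g g' ∧ adj H h h')
   ∨ (adj G g g' ∧ eqF h h')
   ∨ (adj G g g' ∧ adj H h h')
   ∨ (not (eqF g g') ∧ not (eqF h h') ∧ not (adj G g g') ∧ not (adj H h h')))

_⋄_ : Graph → Graph → Graph
G ⋄ H = mkGraph (order G * order H) λ x y →
  let (g , h)   = remQuot (order H) x
      (g' , h') = remQuot (order H) y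
  in modAdj G H g h g' h'

Adj : (G : Graph) → Fin (order G) → Fin (order G) → Set
Adj G u v = adj G u v ≡ true

IsDominating : (G : Graph) → Subset (order G) → Set
IsDominating G D = ∀ v → v ∈ D ⊎ (∃[ u ] (u ∈ D × Adj G u v))

DominationNumber : Graph → ℕ → Set
DominationNumber G m =
  (∃[ D ] (IsDominating G D × ∣ D ∣ ≡ m)) ×
  (∀ D → IsDominating G D → m Data.Nat.≤ ∣ D ∣)

-- In G ⋄ H, (g, h) dominates (g′, h′) exactly when g ∈ N[g′] ⇔ h ∈ N[h′] (closed neighbourhoods).
-- So one column carrying a set S of the Petersen graph P dominates G ⋄ P as soon as every N[h]
-- meets S and misses a vertex of S; S = {0, 1, 3, 7} does. Conversely let G have at least 10
-- vertices and maximum degree ≤ 2. Given three vertices (gᵢ, hᵢ), some column g avoids every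
-- N[gᵢ], and (g, h) is undominated for any h common to all N[hᵢ]; when there is no such h,
-- a finite check over P finds an undominated vertex in the column of g₁.
module Submission where

open import Defs
open import Data.Bool using (Bool; true; false; not; _∧_; _∨_)
open import Data.Bool.Properties using (T-≡; T-∨; not-¬; ¬-not) renaming (_≟_ to _≟ᵇ_)
open import Data.Fin using (Fin; zero; suc; toℕ; combine; remQuot; _↑ˡ_)
open import Data.Fin.Properties
  using (toℕ-injective; remQuot-combine; combine-remQuot; pigeonhole; ¬∀⟶∃¬; any?; all?; <⇒≢; toℕ<n)
open import Data.Fin.Subset using (Subset; _∈_; ∣_∣; inside; outside; ⊥)
open import Data.Fin.Subset.Properties using (_∈?_; ∣⊥∣≡0)
open import Data.Nat as ℕ using (ℕ; _≤_; suc; pred; _<_; _*_; _%_; s≤s; s≤s⁻¹; z≤n)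
open import Data.Nat.DivMod using (n%n≡0; m≤n⇒m%n≡m)
open import Data.Nat.Properties using (≡ᵇ⇒≡; ≡⇒≡ᵇ; ≰⇒>; m≤n⇒m<n∨m≡n)
open import Data.Product using (_×_; ∃; _,_; proj₁; proj₂; uncurry)
open import Data.Sum as Sum using (_⊎_; inj₁; inj₂; [_,_]′)
open import Data.Vec using ([]; _∷_; _++_; lookup; tabulate; here; there)
open import Data.Vec.Properties using (lookup∘tabulate)
open import Function using (_∘_; _⇔_; mk⇔; Equivalence)
open import Relation.Binary.PropositionalEquality
open import Relation.Nullary using (¬_; Dec)
open import Relation.Nullary.Decidable using (toWitness; _×-dec_; _⊎-dec_; _→-dec_; map′)
open import Relation.Unary using (Decidable)

ClosedAdj : (G : Graph) → Fin (order G) → Fin (order G) → Set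
ClosedAdj G u v = u ≡ v ⊎ Adj G u v

dominating⇒closedAdj : ∀ {K D} → IsDominating K D → ∀ v → ∃ λ u → u ∈ D × ClosedAdj K u v
dominating⇒closedAdj dominating v with dominating v
... | inj₁ v∈D              = v , v∈D , inj₁ refl
... | inj₂ (u , u∈D , u~v) = u , u∈D , inj₂ u~v

closedAdj⇒dominated : ∀ {K D u v} → u ∈ D → ClosedAdj K u v → v ∈ D ⊎ ∃ λ u → u ∈ D × Adj K u v
closedAdj⇒dominated u∈D (inj₁ refl) = inj₁ u∈D
closedAdj⇒dominated u∈D (inj₂ u~v)  = inj₂ (_ , u∈D , u~v)

closedAdjᵇ : (G : Graph) → Fin (order G) → Fin (order G) → Bool
closedAdjᵇ G u v = eqF u v ∨ adj G u v

eqF⇒≡ : ∀ {n} {i j : Fin n} → eqF i j ≡ true → i ≡ j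
eqF⇒≡ {i = i} {j} e = toℕ-injective (≡ᵇ⇒≡ (toℕ i) (toℕ j) (Equivalence.from T-≡ e))

eqF-refl : ∀ {n} (i : Fin n) → eqF i i ≡ true
eqF-refl i = Equivalence.to T-≡ (≡⇒≡ᵇ (toℕ i) (toℕ i) refl)

closedAdjᵇ-refl : (G : Graph) (u : Fin (order G)) → closedAdjᵇ G u u ≡ true
closedAdjᵇ-refl G u = cong (_∨ adj G u u) (eqF-refl u)

-- modAdj G H g h g' h' unfolds to modAdjᵇ (eqF g g') (adj G g g') (eqF h h') (adj H h h').
modAdjᵇ : Bool → Bool → Bool → Bool → Bool
modAdjᵇ eg ag eh ah = not (eg ∧ eh) ∧
  ((eg ∧ ah) ∨ (ag ∧ eh) ∨ (ag ∧ ah) ∨ (not eg ∧ not eh ∧ not ag ∧ not ah))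

modAdjᵇ-sound : ∀ eg ag eh ah → modAdjᵇ eg ag eh ah ≡ true → eg ∨ ag ≡ eh ∨ ah
modAdjᵇ-sound true  _     true  _     ()
modAdjᵇ-sound true  _     false true  _  = refl
modAdjᵇ-sound true  true  false false ()
modAdjᵇ-sound true  false false false ()
modAdjᵇ-sound false true  true  _     _  = refl
modAdjᵇ-sound false false true  true  ()
modAdjᵇ-sound false false true  false ()
modAdjᵇ-sound false true  false true  _  = refl
modAdjᵇ-sound false true  false false ()
modAdjᵇ-sound false false false true  ()
modAdjᵇ-sound false false false false _  = refl

modAdjᵇ-complete : ∀ eg ag eh ah → eg ∨ ag ≡ eh ∨ ah →
  (eg ≡ true × eh ≡ true) ⊎ modAdjᵇ eg ag eh ah ≡ true
modAdjᵇ-complete true  _     true  _     _  = inj₁ (refl , refl)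
modAdjᵇ-complete true  _     false true  _  = inj₂ refl
modAdjᵇ-complete false true  true  _     _  = inj₂ refl
modAdjᵇ-complete false true  false true  _  = inj₂ refl
modAdjᵇ-complete false false false false _  = inj₂ refl
modAdjᵇ-complete true  _     false false ()
modAdjᵇ-complete false true  false false ()
modAdjᵇ-complete false false true  _     ()
modAdjᵇ-complete false false false true  ()

module _ (G H : Graph) where

  col : Fin (order G * order H) → Fin (order G)
  col x = proj₁ (remQuot {order G} (order H) x)

  row : Fin (order G * order H) → Fin (order H)
  row x = proj₂ (remQuot {order G} (order H) x)

  col-combine : ∀ g h → col (combine g h) ≡ g
  col-combine g h = cong proj₁ (remQuot-combine {order G} g h)

  row-combine : ∀ g h → row (combine g h) ≡ h
  row-combine g h = cong proj₂ (remQuot-combine {order G} g h)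

  coordinates-injective : ∀ {x y} → col x ≡ col y → row x ≡ row y → x ≡ y
  coordinates-injective {x} {y} c r = begin
    x                        ≡⟨ combine-remQuot {order G} (order H) x ⟨
    combine (col x) (row x)  ≡⟨ cong₂ (combine {order G}) c r ⟩
    combine (col y) (row y)  ≡⟨ combine-remQuot {order G} (order H) y ⟩
    y                        ∎
    where open ≡-Reasoning

  ⋄-closedAdj : ∀ x y →
    ClosedAdj (G ⋄ H) x y ⇔ (closedAdjᵇ G (col x) (col y) ≡ closedAdjᵇ H (row x) (row y))
  ⋄-closedAdj x y = mk⇔ to from
    where
    to : ClosedAdj (G ⋄ H) x y → closedAdjᵇ G (col x) (col y) ≡ closedAdjᵇ H (row x) (row y)
    to (inj₁ refl) = trans (closedAdjᵇ-refl G (col x)) (sym (closedAdjᵇ-refl H (row x)))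
    to (inj₂ x~y)  = modAdjᵇ-sound (eqF (col x) (col y)) (adj G (col x) (col y))
                                   (eqF (row x) (row y)) (adj H (row x) (row y)) x~y
    from : closedAdjᵇ G (col x) (col y) ≡ closedAdjᵇ H (row x) (row y) → ClosedAdj (G ⋄ H) x y
    from same with modAdjᵇ-complete (eqF (col x) (col y)) (adj G (col x) (col y))
                                    (eqF (row x) (row y)) (adj H (row x) (row y)) same
    ... | inj₁ (c , r) = inj₁ (coordinates-injective (eqF⇒≡ c) (eqF⇒≡ r))
    ... | inj₂ x~y     = inj₂ x~y

  combine-closedAdj : ∀ g h y →
    closedAdjᵇ G g (col y) ≡ closedAdjᵇ H h (row y) → ClosedAdj (G ⋄ H) (combine g h) y
  combine-closedAdj g h y same = Equivalence.from (⋄-closedAdj (combine g h) y)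
    (subst₂ (λ g′ h′ → closedAdjᵇ G g′ (col y) ≡ closedAdjᵇ H h′ (row y))
            (sym (col-combine g h)) (sym (row-combine g h)) same)

  combine-¬closedAdj : ∀ x g h →
    closedAdjᵇ H (row x) h ≡ not (closedAdjᵇ G (col x) g) → ¬ ClosedAdj (G ⋄ H) x (combine g h)
  combine-¬closedAdj x g h differ x~v = not-¬ (sym same) differ
    where
    same : closedAdjᵇ G (col x) g ≡ closedAdjᵇ H (row x) h
    same = subst₂ (λ g′ h′ → closedAdjᵇ G (col x) g′ ≡ closedAdjᵇ H (row x) h′)
                  (col-combine g h) (row-combine g h) (Equivalence.to (⋄-closedAdj x (combine g h)) x~v)

∈-++⁺ˡ : ∀ {m n} {p : Subset m} {x} (q : Subset n) → x ∈ p → (x ↑ˡ n) ∈ p ++ q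
∈-++⁺ˡ q here        = here
∈-++⁺ˡ q (there x∈p) = there (∈-++⁺ˡ q x∈p)

∣p++⊥∣≡∣p∣ : ∀ {m n} (p : Subset m) → ∣ p ++ ⊥ {n} ∣ ≡ ∣ p ∣
∣p++⊥∣≡∣p∣ {n = n} []   = ∣⊥∣≡0 n
∣p++⊥∣≡∣p∣ (inside  ∷ p) = cong suc (∣p++⊥∣≡∣p∣ p)
∣p++⊥∣≡∣p∣ (outside ∷ p) = ∣p++⊥∣≡∣p∣ p

ClosedNeighbourhoodsSplit : (H : Graph) → Subset (order H) → Set
ClosedNeighbourhoodsSplit H S = ∀ h b → ∃ λ s → s ∈ S × closedAdjᵇ H s h ≡ b

split⇒firstColumnDominates : ∀ {H S} → ClosedNeighbourhoodsSplit H S →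
  ∀ k (a : Fin (suc k) → Fin (suc k) → Bool) → IsDominating (mkGraph (suc k) a ⋄ H) (S ++ ⊥)
split⇒firstColumnDominates {H} {S} split k a v =
  let (s , s∈S , same) = split (row G H v) (closedAdjᵇ G zero (col G H v)) in
  closedAdj⇒dominated {K = G ⋄ H} {D = S ++ ⊥} (∈-++⁺ˡ ⊥ s∈S) (combine-closedAdj G H zero s v (sym same))
  where G = mkGraph (suc k) a

elements : ∀ {n} (p : Subset n) → Fin ∣ p ∣ → Fin n
elements (inside  ∷ p) zero    = zero
elements (inside  ∷ p) (suc i) = suc (elements p i)
elements (outside ∷ p) i       = suc (elements p i)

elements-complete : ∀ {n} (p : Subset n) {x} → x ∈ p → ∃ λ i → elements p i ≡ x
elements-complete (inside ∷ p) here = zero , refl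
elements-complete (inside ∷ p) (there x∈p) with elements-complete p x∈p
... | i , refl = suc i , refl
elements-complete (outside ∷ p) (there x∈p) with elements-complete p x∈p
... | i , refl = i , refl

pad : ∀ {a} {A : Set a} {s r} → s ≤ r → A → (Fin s → A) → Fin r → A
pad z≤n      d f _       = d
pad (s≤s le) d f zero    = f zero
pad (s≤s le) d f (suc j) = pad le d (f ∘ suc) j

pad-complete : ∀ {a} {A : Set a} {s r} (le : s ≤ r) (d : A) (f : Fin s → A) i →
  ∃ λ j → pad le d f j ≡ f i
pad-complete (s≤s le) d f zero    = zero , refl
pad-complete (s≤s le) d f (suc i) with pad-complete le d (f ∘ suc) i
... | j , e = suc j , e

enumerate : ∀ {n r} (p : Subset n) → ∣ p ∣ ≤ r → Fin n →
  ∃ λ (xs : Fin r → Fin n) → ∀ {x} → x ∈ p → ∃ λ i → xs i ≡ x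
enumerate p ∣p∣≤r d = pad ∣p∣≤r d (elements p) , covers
  where
  covers : ∀ {x} → x ∈ p → ∃ λ i → pad ∣p∣≤r d (elements p) i ≡ x
  covers x∈p with elements-complete p x∈p
  ... | i , refl = pad-complete ∣p∣≤r d (elements p) i

LeavesUndominated : Graph → ℕ → Set
LeavesUndominated K r = ∀ (xs : Fin r → Fin (order K)) → ∃ λ v → ∀ i → ¬ ClosedAdj K (xs i) v

leavesUndominated⇒¬dominating : ∀ {K r} → Fin (order K) → LeavesUndominated K r →
  ∀ {D} → ∣ D ∣ ≤ r → ¬ IsDominating K D
leavesUndominated⇒¬dominating v₀ undominated {D} ∣D∣≤r dominating
  with enumerate D ∣D∣≤r v₀
... | xs , covers with undominated xs
...   | v , free with dominating⇒closedAdj dominating v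
...     | u , u∈D , u≈v with covers u∈D
...       | i , refl = free i u≈v

leavesUndominated⇒<∣D∣ : ∀ {K r} → Fin (order K) → LeavesUndominated K r →
  ∀ D → IsDominating K D → r < ∣ D ∣
leavesUndominated⇒<∣D∣ v₀ undominated D dominating =
  ≰⇒> λ ∣D∣≤r → leavesUndominated⇒¬dominating v₀ undominated ∣D∣≤r dominating

∃-avoiding : ∀ {m n} → m < n → (c : Fin m → ℕ) → ∃ λ (g : Fin n) → ∀ j → toℕ g ≢ c j
∃-avoiding {n = n} m<n c
  with ¬∀⟶∃¬ n (λ g → ∃ λ j → toℕ g ≡ c j) (λ g → any? λ j → toℕ g ℕ.≟ c j) ¬allHit
  where
  ¬allHit : ¬ (∀ g → ∃ λ j → toℕ g ≡ c j)
  ¬allHit hit with pigeonhole m<n (proj₁ ∘ hit)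
  ... | g , g′ , g<g′ , same =
    <⇒≢ g<g′ (toℕ-injective (trans (proj₂ (hit g)) (trans (cong c same) (sym (proj₂ (hit g′))))))
... | g , missed = g , λ j hit → missed (j , hit)

-- Neighbours are listed as naturals (repetitions allowed), so that e.g. a ∸ 1 needs no bounds proof.
ClosedNeighbourhoodsAtMost : ℕ → Graph → Set
ClosedNeighbourhoodsAtMost m G = ∃ λ (nbhd : Fin (order G) → Fin m → ℕ) →
  ∀ a g → closedAdjᵇ G a g ≡ true → ∃ λ j → toℕ g ≡ nbhd a j

farVertex : ∀ {m r G} → ClosedNeighbourhoodsAtMost m G → r * m < order G →
  (gs : Fin r → Fin (order G)) → ∃ λ g → ∀ i → closedAdjᵇ G (gs i) g ≡ false
farVertex {m} {r} {G} (nbhd , listed) r*m<∣G∣ gs = g , far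
  where
  candidates : Fin (r * m) → ℕ
  candidates x = uncurry (nbhd ∘ gs) (remQuot {r} m x)
  g = proj₁ (∃-avoiding r*m<∣G∣ candidates)
  far : ∀ i → closedAdjᵇ G (gs i) g ≡ false
  far i = ¬-not λ adjacent → let (j , hit) = listed (gs i) g adjacent in
    proj₂ (∃-avoiding r*m<∣G∣ candidates) (combine i j)
      (trans hit (cong (uncurry (nbhd ∘ gs)) (sym (remQuot-combine i j))))

Escapes : ∀ {r} (H : Graph) → (Fin r → Fin (order H)) → (Fin r → Bool) → Set
Escapes H hs cs = ∃ λ h → ∀ i → closedAdjᵇ H (hs i) h ≡ not (cs i)

escapes? : ∀ {r} (H : Graph) hs cs → Dec (Escapes {r} H hs cs)
escapes? H hs cs = any? λ h → all? λ i → closedAdjᵇ H (hs i) h ≟ᵇ not (cs i)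

escapes-cong : ∀ {r H} {hs hs′ : Fin r → Fin (order H)} {cs cs′} →
  hs ≗ hs′ → cs ≗ cs′ → Escapes H hs cs → Escapes H hs′ cs′
escapes-cong {H = H} hs≗ cs≗ (h , escape) =
  h , λ i → subst₂ (λ h′ c → closedAdjᵇ H h′ h ≡ not c) (hs≗ i) (cs≗ i) (escape i)

escape⇒undominated : ∀ G H {r} (xs : Fin r → Fin (order G * order H)) g →
  Escapes H (row G H ∘ xs) (λ i → closedAdjᵇ G (col G H (xs i)) g) →
  ∃ λ v → ∀ i → ¬ ClosedAdj (G ⋄ H) (xs i) v
escape⇒undominated G H xs g (h , escape) =
  combine g h , λ i → combine-¬closedAdj G H (xs i) g h (escape i)

∀-Bool? : ∀ {p} {P : Bool → Set p} → Decidable P → Dec (∀ b → P b)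
∀-Bool? P? = map′ (λ { (t , f) true → t ; (t , f) false → f }) (λ p → p true , p false)
                  (P? true ×-dec P? false)

petersenSplitter : Subset 10
petersenSplitter =
  inside ∷ inside ∷ outside ∷ inside ∷ outside ∷ outside ∷ outside ∷ inside ∷ outside ∷ outside ∷ []

petersen-split : ClosedNeighbourhoodsSplit Petersen petersenSplitter
petersen-split = toWitness {a? = all? λ h → ∀-Bool? λ b → any? λ s →
  s ∈? petersenSplitter ×-dec closedAdjᵇ Petersen s h ≟ᵇ b} _

petersen-escapes : (hs : Fin 3 → Fin 10) (cs : Fin 3 → Bool) → cs zero ≡ true →
  Escapes Petersen hs (λ _ → false) ⊎ Escapes Petersen hs cs
petersen-escapes hs cs c₀ =
  Sum.map (escapes-cong {H = Petersen} rows (λ _ → refl))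
          (escapes-cong {H = Petersen} rows (lookup∘tabulate cs))
    (table (hs zero) (hs (suc zero)) (hs (suc (suc zero)))
           (cs zero) (cs (suc zero)) (cs (suc (suc zero))) c₀)
  where
  rows : lookup (tabulate hs) ≗ hs
  rows = lookup∘tabulate hs
  table : ∀ (h₁ h₂ h₃ : Fin 10) c₁ c₂ c₃ → c₁ ≡ true →
    Escapes Petersen (lookup (h₁ ∷ h₂ ∷ h₃ ∷ [])) (λ _ → false) ⊎
    Escapes Petersen (lookup (h₁ ∷ h₂ ∷ h₃ ∷ [])) (lookup (c₁ ∷ c₂ ∷ c₃ ∷ []))
  table = toWitness {a? = all? λ h₁ → all? λ h₂ → all? λ h₃ →
                          ∀-Bool? λ c₁ → ∀-Bool? λ c₂ → ∀-Bool? λ c₃ →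
    c₁ ≟ᵇ true →-dec
      (escapes? Petersen (lookup (h₁ ∷ h₂ ∷ h₃ ∷ [])) (λ _ → false) ⊎-dec
       escapes? Petersen (lookup (h₁ ∷ h₂ ∷ h₃ ∷ [])) (lookup (c₁ ∷ c₂ ∷ c₃ ∷ [])))} _

petersen-leavesUndominated : ∀ {G} → ClosedNeighbourhoodsAtMost 3 G → 9 < order G →
  LeavesUndominated (G ⋄ Petersen) 3
petersen-leavesUndominated {G} nbhds 9<∣G∣ xs =
  [ inFarColumn , escape⇒undominated G Petersen xs (gs zero) ]′
    (petersen-escapes hs (λ i → closedAdjᵇ G (gs i) (gs zero)) (closedAdjᵇ-refl G (gs zero)))
  where
  gs = col G Petersen ∘ xs
  hs = row G Petersen ∘ xs
  far = farVertex nbhds 9<∣G∣ gs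
  inFarColumn : Escapes Petersen hs (λ _ → false) → ∃ λ v → ∀ i → ¬ ClosedAdj (G ⋄ Petersen) (xs i) v
  inFarColumn escape = escape⇒undominated G Petersen xs (proj₁ far)
    (escapes-cong {H = Petersen} {hs = hs} (λ _ → refl) (λ i → sym (proj₂ far i)) escape)

γ[G⋄Petersen]≡4 : ∀ G → 9 < order G → ClosedNeighbourhoodsAtMost 3 G → DominationNumber (G ⋄ Petersen) 4
γ[G⋄Petersen]≡4 (mkGraph (suc k) a) 9<∣G∣ nbhds =
  (petersenSplitter ++ ⊥ , split⇒firstColumnDominates petersen-split k a ,
   ∣p++⊥∣≡∣p∣ {n = k * 10} petersenSplitter) ,
  leavesUndominated⇒<∣D∣ (combine {suc k} {10} zero zero) (petersen-leavesUndominated nbhds 9<∣G∣)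

≡ᵇ-∨₃ : ∀ a b c d e f → ((a ℕ.≡ᵇ b) ∨ (c ℕ.≡ᵇ d) ∨ (e ℕ.≡ᵇ f)) ≡ true → a ≡ b ⊎ c ≡ d ⊎ e ≡ f
≡ᵇ-∨₃ a b c d e f holds with Equivalence.to T-∨ (Equivalence.from T-≡ holds)
... | inj₁ a≡b = inj₁ (≡ᵇ⇒≡ a b a≡b)
... | inj₂ rest with Equivalence.to T-∨ rest
...   | inj₁ c≡d = inj₂ (inj₁ (≡ᵇ⇒≡ c d c≡d))
...   | inj₂ e≡f = inj₂ (inj₂ (≡ᵇ⇒≡ e f e≡f))

path-closedNeighbourhoods : ∀ k → ClosedNeighbourhoodsAtMost 3 (Path k)
path-closedNeighbourhoods k = nbhd , listed
  where
  nbhd : Fin k → Fin 3 → ℕ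
  nbhd a = lookup (toℕ a ∷ suc (toℕ a) ∷ pred (toℕ a) ∷ [])
  listed : ∀ a g → closedAdjᵇ (Path k) a g ≡ true → ∃ λ j → toℕ g ≡ nbhd a j
  listed a g adjacent with ≡ᵇ-∨₃ (toℕ a) (toℕ g) (suc (toℕ a)) (toℕ g) (suc (toℕ g)) (toℕ a) adjacent
  ... | inj₁ same           = zero , sym same
  ... | inj₂ (inj₁ after)   = suc zero , sym after
  ... | inj₂ (inj₂ before) = suc (suc zero) , cong pred before

cyclePred : ℕ → ℕ → ℕ
cyclePred k ℕ.zero  = k
cyclePred k (suc a) = a

cyclePred-suc% : ∀ {k g} → g < suc k → cyclePred k (suc g % suc k) ≡ g
cyclePred-suc% {k} {g} g<1+k with m≤n⇒m<n∨m≡n (s≤s⁻¹ g<1+k)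
... | inj₁ g<k  = cong (cyclePred k) (m≤n⇒m%n≡m g<k)
... | inj₂ refl = cong (cyclePred k) (n%n≡0 (suc k))

cycle-closedNeighbourhoods : ∀ k → ClosedNeighbourhoodsAtMost 3 (Cycle k)
cycle-closedNeighbourhoods ℕ.zero  = (λ ()) , λ ()
cycle-closedNeighbourhoods (suc k) = nbhd , listed
  where
  nbhd : Fin (suc k) → Fin 3 → ℕ
  nbhd a = lookup (toℕ a ∷ suc (toℕ a) % suc k ∷ cyclePred k (toℕ a) ∷ [])
  listed : ∀ a g → closedAdjᵇ (Cycle (suc k)) a g ≡ true → ∃ λ j → toℕ g ≡ nbhd a j
  listed a g adjacent
    with ≡ᵇ-∨₃ (toℕ a) (toℕ g) (suc (toℕ a) % suc k) (toℕ g) (suc (toℕ g) % suc k) (toℕ a) adjacent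
  ... | inj₁ same          = zero , sym same
  ... | inj₂ (inj₁ after)  = suc zero , sym after
  ... | inj₂ (inj₂ before) = suc (suc zero) , trans (sym (cyclePred-suc% (toℕ<n g))) (cong (cyclePred k) before)

proposition31 : (k : ℕ) → 10 ≤ k →
    DominationNumber (Path k ⋄ Petersen) 4 × DominationNumber (Cycle k ⋄ Petersen) 4
proposition31 k 10≤k =
  γ[G⋄Petersen]≡4 (Path k) 10≤k (path-closedNeighbourhoods k) ,
  γ[G⋄Petersen]≡4 (Cycle k) 10≤k (cycle-closedNeighbourhoods k)
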